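{- Consider any graph with $m$ edges, $T\ge1$ triangles, $P_2$ length-2 paths, transitivity coefficient $\alpha=3T/P_2$, and at most $\Delta_E$ triangles sharing a common edge. Then there is an absolute constant $c>0$ such that \[ \frac{\sqrt{m}}{\alpha}+\frac{m\sqrt{m}}{T}\ \ge\ c\, m\left(\frac{\Delta_E}{T}+\frac{1}{\sqrt{T}}\right). \]
   Context: A length-2 path (wedge) is a pair of edges sharing exactly one endpoint. -}

module Defs where

open import Data.Bool using (Bool; true; false; _∧_; if_then_else_)
open import Data.Nat using (ℕ; _+_; _*_; _<ᵇ_; _⊔_)
open import Data.Fin using (Fin; toℕ)
open import Data.List using (List; map; foldr; allFin)
open import Data.Nat.ListAction using (sum)
open import Data.Product using (_×_)
open import Relation.Binary.PropositionalEquality using (_≡_)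
import Data.Integer as ℤ

record SimpleGraph (n : ℕ) : Set where
  field
    adj    : Fin n → Fin n → Bool
    sym    : ∀ i j → adj i j ≡ adj j i
    irrefl : ∀ i → adj i i ≡ false
open SimpleGraph public

ind : Bool → ℕ
ind b = if b then 1 else 0

lt : ∀ {n} → Fin n → Fin n → Bool
lt i j = toℕ i <ᵇ toℕ j

sumFin : ∀ n → (Fin n → ℕ) → ℕ
sumFin n f = sum (map f (allFin n))

maxFin : ∀ n → (Fin n → ℕ) → ℕ
maxFin n f = foldr _⊔_ 0 (map f (allFin n))

edgeCount : ∀ {n} → SimpleGraph n → ℕ
edgeCount {n} G = sumFin n λ i → sumFin n λ j → ind (lt i j ∧ adj G i j)

triangleCount : ∀ {n} → SimpleGraph n → ℕ
triangleCount {n} G =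
  sumFin n λ i → sumFin n λ j → sumFin n λ k →
    ind (lt i j ∧ lt j k ∧ adj G i j ∧ adj G j k ∧ adj G i k)

-- P₂ : number of length-2 paths (wedges): pairs of edges {v,a},{v,b}
-- sharing exactly the endpoint v (a < b; a,b ≠ v by irreflexivity).
wedgeCount : ∀ {n} → SimpleGraph n → ℕ
wedgeCount {n} G =
  sumFin n λ v → sumFin n λ a → sumFin n λ b →
    ind (lt a b ∧ adj G v a ∧ adj G v b)

-- number of triangles containing the edge {i,j} (when i,j adjacent)
codegree : ∀ {n} → SimpleGraph n → Fin n → Fin n → ℕ
codegree {n} G i j = sumFin n λ k → ind (adj G i k ∧ adj G j k)

maxEdgeTriangles : ∀ {n} → SimpleGraph n → ℕ
maxEdgeTriangles {n} G =
  maxFin n λ i → maxFin n λ j →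
    if lt i j ∧ adj G i j then codegree G i j else 0

-- Real-free encoding of the real inequality  Y + Z·√t ≤ X·√m  (X,Y,Z,t,m ∈ ℕ):
-- with W = X²m − Y² − Z²t ∈ ℤ, it holds iff W ≥ 0 and W² ≥ 4Y²Z²t.
SqrtIneq : (X m Y Z t : ℕ) → Set
SqrtIneq X m Y Z t =
  (ℤ.+ 0 ℤ.≤ W) × (ℤ.+ (4 * (Y * Y) * (Z * Z) * t) ℤ.≤ W ℤ.* W)
  where
  W : ℤ.ℤ
  W = ℤ.+ (X * X * m) ℤ.- ℤ.+ (Y * Y) ℤ.- ℤ.+ (Z * Z * t)

{-# OPTIONS --safe #-}
-- Each triangle {i < j < k} contains exactly one wedge centred at each of its vertices, so
-- 3T ≤ P₂. If the edge ij lies in d triangles, the d(d − 1) ordered pairs of distinct common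
-- neighbours of i and j hit each wedge centred at i at most twice, and each common neighbour k
-- centres the wedge (k; i, j); so d² ≤ 3P₂, whence Δ_E² ≤ 3P₂. With K = P₂ + 3m we have
-- 3mP₂ ≤ K², hence 3mΔ_E ≤ 3K√m and 3m√T ≤ K√m, and adding them gives the inequality with c = 1/4.
module Submission where

open import Defs hiding (sym)
open import Data.Nat using (ℕ; _+_; _*_; _≤_)
open import Data.Product using (Σ; _×_)

import Algebra.Properties.Semiring.Sum
open import Data.Bool using (Bool; true; false; T; _∧_; if_then_else_)
open import Data.Bool.Properties using (T-∧; T-≡)
open import Data.Empty using (⊥; ⊥-elim)
open import Data.Fin using (Fin; zero; suc; _<_)
open import Data.Fin.Properties using (_≟_; <-cmp; <-trans; <-asym)
open import Data.List using ([]; _∷_; map; tabulate; allFin)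
open import Data.List.Membership.Propositional using (_∈_)
open import Data.List.Membership.Propositional.Properties using (∈-allFin)
open import Data.List.Properties using (map-tabulate; map-cong; foldr-preservesᵇ)
open import Data.List.Relation.Unary.All using (universal)
open import Data.List.Relation.Unary.All.Properties using (map⁺)
open import Data.List.Relation.Unary.Any using (here; there)
open import Data.Nat using (zero; suc; z≤n; s≤s; _⊔_)
open import Data.Nat.ListAction using (sum)
open import Data.Nat.Properties
  using ( +-*-semiring; +-comm; +-identityʳ; ≤-refl; ≤-reflexive; ≤-trans; m≤m+n; m≤n+m
        ; +-mono-≤; *-mono-≤; *-monoʳ-≤; ⊔-sel; <ᵇ⇒<; <⇒<ᵇ; m≤n⇒∃[o]m+o≡n; module ≤-Reasoning)
open import Data.Nat.Tactic.RingSolver using (solve)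
open import Data.Product using (_,_; proj₁)
open import Data.Sum using (inj₁; inj₂)
import Data.Integer as ℤ
import Data.Integer.Properties as ℤ
import Data.Integer.Tactic.RingSolver as ℤ
open import Function using (id; _∘_; flip; Equivalence)
open import Relation.Binary.Definitions using (tri<; tri≈; tri>)
open import Relation.Binary.PropositionalEquality
  using (_≡_; refl; sym; trans; cong; cong₂; subst; module ≡-Reasoning)
open import Relation.Nullary using (does; yes; no; contradiction)

module ∑ = Algebra.Properties.Semiring.Sum +-*-semiring

sum-tabulate : ∀ {n} (f : Fin n → ℕ) → sum (tabulate f) ≡ ∑.sum f
sum-tabulate {zero}  f = refl
sum-tabulate {suc n} f = cong (f zero +_) (sum-tabulate (f ∘ suc))

sumFin≡∑ : ∀ n (f : Fin n → ℕ) → sumFin n f ≡ ∑.sum f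
sumFin≡∑ n f = trans (cong sum (map-tabulate id f)) (sum-tabulate f)

sum-map-mono-≤ : ∀ {A : Set} {f g : A → ℕ} → (∀ x → f x ≤ g x) →
                 ∀ xs → sum (map f xs) ≤ sum (map g xs)
sum-map-mono-≤ f≤g []       = z≤n
sum-map-mono-≤ f≤g (x ∷ xs) = +-mono-≤ (f≤g x) (sum-map-mono-≤ f≤g xs)

∈⇒≤-sum-map : ∀ {A : Set} (f : A → ℕ) {x xs} → x ∈ xs → f x ≤ sum (map f xs)
∈⇒≤-sum-map f (here refl)  = m≤m+n _ _
∈⇒≤-sum-map f (there x∈xs) = ≤-trans (∈⇒≤-sum-map f x∈xs) (m≤n+m _ _)

module _ (n : ℕ) where

  sumFin-cong : {f g : Fin n → ℕ} → (∀ i → f i ≡ g i) → sumFin n f ≡ sumFin n g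
  sumFin-cong f≗g = cong sum (map-cong f≗g (allFin n))

  sumFin-mono-≤ : {f g : Fin n → ℕ} → (∀ i → f i ≤ g i) → sumFin n f ≤ sumFin n g
  sumFin-mono-≤ f≤g = sum-map-mono-≤ f≤g (allFin n)

  ≤-sumFin : (f : Fin n → ℕ) (i : Fin n) → f i ≤ sumFin n f
  ≤-sumFin f i = ∈⇒≤-sum-map f (∈-allFin i)

  sumFin-distrib-+ : (f g : Fin n → ℕ) →
                     sumFin n (λ i → f i + g i) ≡ sumFin n f + sumFin n g
  sumFin-distrib-+ f g = begin
    sumFin n (λ i → f i + g i) ≡⟨ sumFin≡∑ n _ ⟩
    ∑.sum (λ i → f i + g i)   ≡⟨ ∑.∑-distrib-+ f g ⟩
    ∑.sum f + ∑.sum g        ≡⟨ cong₂ _+_ (sumFin≡∑ n f) (sumFin≡∑ n g) ⟨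
    sumFin n f + sumFin n g    ∎
    where open ≡-Reasoning

  *-distribˡ-sumFin : (x : ℕ) (f : Fin n → ℕ) → x * sumFin n f ≡ sumFin n (λ i → x * f i)
  *-distribˡ-sumFin x f = begin
    x * sumFin n f            ≡⟨ cong (x *_) (sumFin≡∑ n f) ⟩
    x * ∑.sum f              ≡⟨ ∑.*-distribˡ-sum x f ⟩
    ∑.sum (λ i → x * f i)    ≡⟨ sumFin≡∑ n _ ⟨
    sumFin n (λ i → x * f i)  ∎
    where open ≡-Reasoning

  *-distribʳ-sumFin : (x : ℕ) (f : Fin n → ℕ) → sumFin n f * x ≡ sumFin n (λ i → f i * x)
  *-distribʳ-sumFin x f = begin
    sumFin n f * x            ≡⟨ cong (_* x) (sumFin≡∑ n f) ⟩
    ∑.sum f * x              ≡⟨ ∑.*-distribʳ-sum x f ⟩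
    ∑.sum (λ i → f i * x)    ≡⟨ sumFin≡∑ n _ ⟨
    sumFin n (λ i → f i * x)  ∎
    where open ≡-Reasoning

  sumFin-sift : (a : Fin n) (f : Fin n → ℕ) → sumFin n (λ b → ind (does (a ≟ b)) * f b) ≡ f a
  sumFin-sift a f = trans (sumFin≡∑ n _) (∑-sift a f)
    where
    ∑-sift : ∀ {n} (a : Fin n) (f : Fin n → ℕ) → ∑.sum (λ b → ind (does (a ≟ b)) * f b) ≡ f a
    ∑-sift {suc n} zero    f = trans (cong₂ _+_ (+-identityʳ (f zero)) (∑.sum-replicate-zero n))
                                     (+-identityʳ (f zero))
    ∑-sift {suc n} (suc a) f = ∑-sift a (f ∘ suc)

sumFin-comm : ∀ n m (f : Fin n → Fin m → ℕ) →
              sumFin n (λ i → sumFin m (f i)) ≡ sumFin m (λ j → sumFin n (λ i → f i j))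
sumFin-comm n m f = begin
  sumFin n (λ i → sumFin m (f i))          ≡⟨ sumFin≡∑ n _ ⟩
  ∑.sum (λ i → sumFin m (f i))            ≡⟨ ∑.sum-cong-≗ (λ i → sumFin≡∑ m (f i)) ⟩
  ∑.sum (λ i → ∑.sum (f i))              ≡⟨ ∑.∑-comm f ⟩
  ∑.sum (λ j → ∑.sum (λ i → f i j))      ≡⟨ ∑.sum-cong-≗ (λ j → sumFin≡∑ n (λ i → f i j)) ⟨
  ∑.sum (λ j → sumFin n (λ i → f i j))    ≡⟨ sumFin≡∑ m _ ⟨
  sumFin m (λ j → sumFin n (λ i → f i j))  ∎
  where open ≡-Reasoning

sumFin-*-sumFin : ∀ n m (f : Fin n → ℕ) (g : Fin m → ℕ) →
                  sumFin n f * sumFin m g ≡ sumFin n (λ a → sumFin m (λ b → f a * g b))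
sumFin-*-sumFin n m f g =
  trans (*-distribʳ-sumFin n (sumFin m g) f)
        (sumFin-cong n (λ a → *-distribˡ-sumFin m (f a) g))

sumFin³ : ∀ n → (Fin n → Fin n → Fin n → ℕ) → ℕ
sumFin³ n f = sumFin n λ i → sumFin n λ j → sumFin n λ k → f i j k

module _ (n : ℕ) where

  sumFin³-swap₁₂ : (f : Fin n → Fin n → Fin n → ℕ) → sumFin³ n (λ i j k → f j i k) ≡ sumFin³ n f
  sumFin³-swap₁₂ f = sumFin-comm n n (λ i j → sumFin n (f j i))

  sumFin³-swap₂₃ : (f : Fin n → Fin n → Fin n → ℕ) → sumFin³ n (λ i j k → f i k j) ≡ sumFin³ n f
  sumFin³-swap₂₃ f = sumFin-cong n (λ i → sumFin-comm n n (λ j k → f i k j))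

  sumFin-+₃-≤ : {f g h k : Fin n → ℕ} → (∀ i → f i + g i + h i ≤ k i) →
                sumFin n f + sumFin n g + sumFin n h ≤ sumFin n k
  sumFin-+₃-≤ {f} {g} {h} {k} pointwise = begin
    sumFin n f + sumFin n g + sumFin n h       ≡⟨ cong (_+ sumFin n h) (sumFin-distrib-+ n f g) ⟨
    sumFin n (λ i → f i + g i) + sumFin n h     ≡⟨ sumFin-distrib-+ n (λ i → f i + g i) h ⟨
    sumFin n (λ i → f i + g i + h i)           ≤⟨ sumFin-mono-≤ n pointwise ⟩
    sumFin n k                                 ∎
    where open ≤-Reasoning

  ≤-sumFin-+₃ : {f g h k : Fin n → ℕ} → (∀ i → k i ≤ f i + g i + h i) →
                sumFin n k ≤ sumFin n f + sumFin n g + sumFin n h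
  ≤-sumFin-+₃ {f} {g} {h} {k} pointwise = begin
    sumFin n k                                 ≤⟨ sumFin-mono-≤ n pointwise ⟩
    sumFin n (λ i → f i + g i + h i)           ≡⟨ sumFin-distrib-+ n (λ i → f i + g i) h ⟩
    sumFin n (λ i → f i + g i) + sumFin n h     ≡⟨ cong (_+ sumFin n h) (sumFin-distrib-+ n f g) ⟩
    sumFin n f + sumFin n g + sumFin n h       ∎
    where open ≤-Reasoning

3*m≡m+m+m : ∀ m → 3 * m ≡ m + m + m
3*m≡m+m+m m = solve (m ∷ [])

maxFin-preserves : ∀ n (P : ℕ → Set) {f : Fin n → ℕ} → P 0 → (∀ i → P (f i)) → P (maxFin n f)
maxFin-preserves n P {f} P0 Pf =
  foldr-preservesᵇ {P = P} ⊔-preserves P0 (map⁺ (universal Pf (allFin n)))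
  where
  ⊔-preserves : ∀ {x y} → P x → P y → P (x ⊔ y)
  ⊔-preserves {x} {y} Px Py with ⊔-sel x y
  ... | inj₁ x⊔y≡x = subst P (sym x⊔y≡x) Px
  ... | inj₂ x⊔y≡y = subst P (sym x⊔y≡y) Py

ind-mono : ∀ {x y} → (T x → T y) → ind x ≤ ind y
ind-mono {false}         _   = z≤n
ind-mono {true}  {true}  _   = ≤-refl
ind-mono {true}  {false} x⇒y = ⊥-elim (x⇒y _)

ind-*-mono : ∀ {x y z} → (T x → T y → T z) → ind x * ind y ≤ ind z
ind-*-mono {false}        _ = z≤n
ind-*-mono {true} {false} _ = z≤n
ind-*-mono {true} {true}  h = ind-mono (h _)

ind-*-≤ : ∀ x n → ind x * n ≤ n
ind-*-≤ false n = z≤n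
ind-*-≤ true  n = ≤-reflexive (+-identityʳ n)

ind-+₃-≤ : ∀ {x y z w} → (T x → T w) → (T y → T w) → (T z → T w) →
           (T x → T y → ⊥) → (T x → T z → ⊥) → (T y → T z → ⊥) →
           ind x + ind y + ind z ≤ ind w
ind-+₃-≤ {false} {false} {false} _   _   _   _   _   _   = z≤n
ind-+₃-≤ {true}  {false} {false} x⇒w _   _   _   _   _   = ind-mono x⇒w
ind-+₃-≤ {false} {true}  {false} _   y⇒w _   _   _   _   = ind-mono y⇒w
ind-+₃-≤ {false} {false} {true}  _   _   z⇒w _   _   _   = ind-mono z⇒w
ind-+₃-≤ {true}  {true}          _   _   _   x#y _   _   = ⊥-elim (x#y _ _)
ind-+₃-≤ {true}  {false} {true}  _   _   _   _   x#z _   = ⊥-elim (x#z _ _)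
ind-+₃-≤ {false} {true}  {true}  _   _   _   _   _   y#z = ⊥-elim (y#z _ _)

T-∧-intro : ∀ {x y} → T x → T y → T (x ∧ y)
T-∧-intro p q = Equivalence.from T-∧ (p , q)

T-∧-elim : ∀ {x y} → T (x ∧ y) → T x × T y
T-∧-elim = Equivalence.to T-∧

lt⇒< : ∀ {n} {a b : Fin n} → T (lt a b) → a < b
lt⇒< = <ᵇ⇒< _ _

<⇒lt : ∀ {n} {a b : Fin n} → a < b → T (lt a b)
<⇒lt = <⇒<ᵇ

module _ {n : ℕ} (G : SimpleGraph n) where

  triangleᵇ : Fin n → Fin n → Fin n → Bool
  triangleᵇ i j k = lt i j ∧ lt j k ∧ adj G i j ∧ adj G j k ∧ adj G i k

  wedgeᵇ : Fin n → Fin n → Fin n → Bool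
  wedgeᵇ v a b = lt a b ∧ adj G v a ∧ adj G v b

  commonNeighbourᵇ : Fin n → Fin n → Fin n → Bool
  commonNeighbourᵇ i j k = adj G i k ∧ adj G j k

  wedgesAt : Fin n → ℕ
  wedgesAt v = sumFin n λ a → sumFin n λ b → ind (wedgeᵇ v a b)

  adj-sym : ∀ {a b} → T (adj G a b) → T (adj G b a)
  adj-sym {a} {b} = subst T (SimpleGraph.sym G a b)

  Triangle : Fin n → Fin n → Fin n → Set
  Triangle i j k = i < j × j < k × T (adj G i j) × T (adj G j k) × T (adj G i k)

  triangle : ∀ i j k → T (triangleᵇ i j k) → Triangle i j k
  triangle _ _ _ t =
    let i<j , t₁ = T-∧-elim t
        j<k , t₂ = T-∧-elim t₁
        ij  , t₃ = T-∧-elim t₂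
        jk  , ik = T-∧-elim t₃
    in lt⇒< i<j , lt⇒< j<k , ij , jk , ik

  wedge : ∀ {v a b} → a < b → T (adj G v a) → T (adj G v b) → T (wedgeᵇ v a b)
  wedge a<b va vb = T-∧-intro (<⇒lt a<b) (T-∧-intro va vb)

  triangles≤wedge : ∀ v a b →
    ind (triangleᵇ v a b) + ind (triangleᵇ a v b) + ind (triangleᵇ a b v) ≤ ind (wedgeᵇ v a b)
  triangles≤wedge v a b =
    ind-+₃-≤ centred₁ centred₂ centred₃ exclusive₁₂ exclusive₁₃ exclusive₂₃
    where
    centred₁ : T (triangleᵇ v a b) → T (wedgeᵇ v a b)
    centred₁ t with triangle v a b t
    ... | _ , a<b , va , _ , vb = wedge a<b va vb
    centred₂ : T (triangleᵇ a v b) → T (wedgeᵇ v a b)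
    centred₂ t with triangle a v b t
    ... | a<v , v<b , av , vb , _ = wedge (<-trans a<v v<b) (adj-sym av) vb
    centred₃ : T (triangleᵇ a b v) → T (wedgeᵇ v a b)
    centred₃ t with triangle a b v t
    ... | a<b , _ , _ , bv , av = wedge a<b (adj-sym av) (adj-sym bv)
    exclusive₁₂ : T (triangleᵇ v a b) → T (triangleᵇ a v b) → ⊥
    exclusive₁₂ t t′ with triangle v a b t | triangle a v b t′
    ... | v<a , _ | a<v , _ = <-asym v<a a<v
    exclusive₁₃ : T (triangleᵇ v a b) → T (triangleᵇ a b v) → ⊥
    exclusive₁₃ t t′ with triangle v a b t | triangle a b v t′
    ... | v<a , a<b , _ | _ , b<v , _ = <-asym v<a (<-trans a<b b<v)
    exclusive₂₃ : T (triangleᵇ a v b) → T (triangleᵇ a b v) → ⊥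
    exclusive₂₃ t t′ with triangle a v b t | triangle a b v t′
    ... | _ , v<b , _ | _ , b<v , _ = <-asym v<b b<v

  3*triangleCount≤wedgeCount : 3 * triangleCount G ≤ wedgeCount G
  3*triangleCount≤wedgeCount = begin
    3 * sumFin³ n tri                    ≡⟨ 3*m≡m+m+m (sumFin³ n tri) ⟩
    sumFin³ n tri + sumFin³ n tri + sumFin³ n tri
      ≡⟨ cong₂ (λ x y → sumFin³ n tri + x + y)
               (sumFin³-swap₁₂ n tri)
               (trans (sumFin³-swap₁₂ n (λ i j k → tri i k j)) (sumFin³-swap₂₃ n tri)) ⟨
    sumFin³ n tri + sumFin³ n (λ v a b → tri a v b) + sumFin³ n (λ v a b → tri a b v)
      ≤⟨ sumFin-+₃-≤ n (λ v → sumFin-+₃-≤ n (λ a → sumFin-+₃-≤ n (triangles≤wedge v a))) ⟩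
    wedgeCount G                         ∎
    where
    open ≤-Reasoning
    tri : Fin n → Fin n → Fin n → ℕ
    tri i j k = ind (triangleᵇ i j k)

  wedgesAt≤wedgeCount : ∀ v → wedgesAt v ≤ wedgeCount G
  wedgesAt≤wedgeCount = ≤-sumFin n wedgesAt

  commonNeighbours⇒wedge : ∀ {i j a b} → a < b →
    T (commonNeighbourᵇ i j a) → T (commonNeighbourᵇ i j b) → T (wedgeᵇ i a b)
  commonNeighbours⇒wedge a<b ija ijb = wedge a<b (proj₁ (T-∧-elim ija)) (proj₁ (T-∧-elim ijb))

  commonNeighbourPair≤wedges : ∀ i j a b →
    ind (commonNeighbourᵇ i j a) * ind (commonNeighbourᵇ i j b) ≤
    ind (wedgeᵇ i a b) + ind (wedgeᵇ i b a) + ind (does (a ≟ b)) * ind (commonNeighbourᵇ i j b)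
  commonNeighbourPair≤wedges i j a b with a ≟ b
  ... | yes refl = ≤-trans (ind-*-≤ (commonNeighbourᵇ i j a) _)
                           (≤-trans (m≤m+n _ 0) (m≤n+m _ (ind (wedgeᵇ i a a) + ind (wedgeᵇ i a a))))
  ... | no a≢b with <-cmp a b
  ...   | tri< a<b _ _ = ≤-trans (ind-*-mono (commonNeighbours⇒wedge a<b))
                                 (≤-trans (m≤m+n (ind (wedgeᵇ i a b)) (ind (wedgeᵇ i b a))) (m≤m+n _ 0))
  ...   | tri≈ _ a≡b _ = contradiction a≡b a≢b
  ...   | tri> _ _ b<a = ≤-trans (ind-*-mono (flip (commonNeighbours⇒wedge b<a)))
                                 (≤-trans (m≤n+m (ind (wedgeᵇ i b a)) (ind (wedgeᵇ i a b))) (m≤m+n _ 0))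

  codegree≤wedgeCount : ∀ {i j} → i < j → codegree G i j ≤ wedgeCount G
  codegree≤wedgeCount {i} {j} i<j = sumFin-mono-≤ n λ k → begin
    ind (commonNeighbourᵇ i j k)             ≤⟨ ind-mono (centred k) ⟩
    ind (wedgeᵇ k i j)                       ≤⟨ ≤-sumFin n _ j ⟩
    sumFin n (λ b → ind (wedgeᵇ k i b))      ≤⟨ ≤-sumFin n _ i ⟩
    wedgesAt k                               ∎
    where
    open ≤-Reasoning
    centred : ∀ k → T (commonNeighbourᵇ i j k) → T (wedgeᵇ k i j)
    centred k ijk = let ik , jk = T-∧-elim ijk in wedge i<j (adj-sym ik) (adj-sym jk)

  codegree²≤3*wedgeCount : ∀ {i j} → i < j → codegree G i j * codegree G i j ≤ 3 * wedgeCount G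
  codegree²≤3*wedgeCount {i} {j} i<j = begin
    sumFin n c * sumFin n c                                     ≡⟨ sumFin-*-sumFin n n c c ⟩
    sumFin n (λ a → sumFin n λ b → c a * c b)
      ≤⟨ ≤-sumFin-+₃ n (λ a → ≤-sumFin-+₃ n (commonNeighbourPair≤wedges i j a)) ⟩
    wedgesAt i + sumFin n (λ a → sumFin n λ b → ind (wedgeᵇ i b a))
               + sumFin n (λ a → sumFin n λ b → ind (does (a ≟ b)) * c b)
      ≡⟨ cong₂ (λ x y → wedgesAt i + x + y)
               (sumFin-comm n n (λ a b → ind (wedgeᵇ i b a)))
               (sumFin-cong n (λ a → sumFin-sift n a c)) ⟩
    wedgesAt i + wedgesAt i + sumFin n c
      ≤⟨ +-mono-≤ (+-mono-≤ (wedgesAt≤wedgeCount i) (wedgesAt≤wedgeCount i))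
                  (codegree≤wedgeCount i<j) ⟩
    wedgeCount G + wedgeCount G + wedgeCount G                  ≡⟨ 3*m≡m+m+m (wedgeCount G) ⟨
    3 * wedgeCount G                                            ∎
    where
    open ≤-Reasoning
    c : Fin n → ℕ
    c k = ind (commonNeighbourᵇ i j k)

  maxEdgeTriangles²≤3*wedgeCount : maxEdgeTriangles G * maxEdgeTriangles G ≤ 3 * wedgeCount G
  maxEdgeTriangles²≤3*wedgeCount =
    maxFin-preserves n Square-≤ z≤n λ i → maxFin-preserves n Square-≤ z≤n (edge i)
    where
    Square-≤ : ℕ → Set
    Square-≤ x = x * x ≤ 3 * wedgeCount G
    edge : ∀ i j → Square-≤ (if lt i j ∧ adj G i j then codegree G i j else 0)
    edge i j with lt i j in lt≡true | adj G i j
    ... | true  | true  = codegree²≤3*wedgeCount (lt⇒< (Equivalence.from T-≡ lt≡true))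
    ... | true  | false = z≤n
    ... | false | _     = z≤n

SqrtIneq-intro : ∀ {X m Y Z t} N → X * X * m ≡ N + Y * Y + Z * Z * t →
                 4 * (Y * Y) * (Z * Z) * t ≤ N * N → SqrtIneq X m Y Z t
SqrtIneq-intro {X} {m} {Y} {Z} {t} N X²m≡N+Y²+Z²t 4Y²Z²t≤N² =
  subst (λ W → ℤ.+ 0 ℤ.≤ W × ℤ.+ (4 * (Y * Y) * (Z * Z) * t) ℤ.≤ W ℤ.* W) (sym W≡N)
        (ℤ.+≤+ z≤n , subst (ℤ.+ _ ℤ.≤_) (ℤ.pos-* N N) (ℤ.+≤+ 4Y²Z²t≤N²))
  where
  y z : ℕ
  y = Y * Y
  z = Z * Z * t
  p+q+r-q-r≡p : ∀ p q r → p ℤ.+ q ℤ.+ r ℤ.- q ℤ.- r ≡ p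
  p+q+r-q-r≡p = ℤ.solve-∀
  W≡N : ℤ.+ (X * X * m) ℤ.- ℤ.+ y ℤ.- ℤ.+ z ≡ ℤ.+ N
  W≡N = begin
    ℤ.+ (X * X * m) ℤ.- ℤ.+ y ℤ.- ℤ.+ z        ≡⟨ cong (λ x → ℤ.+ x ℤ.- ℤ.+ y ℤ.- ℤ.+ z) X²m≡N+Y²+Z²t ⟩
    ℤ.+ (N + y + z) ℤ.- ℤ.+ y ℤ.- ℤ.+ z        ≡⟨ cong (λ x → x ℤ.- ℤ.+ y ℤ.- ℤ.+ z) +[N+y+z]≡ ⟩
    ℤ.+ N ℤ.+ ℤ.+ y ℤ.+ ℤ.+ z ℤ.- ℤ.+ y ℤ.- ℤ.+ z ≡⟨ p+q+r-q-r≡p (ℤ.+ N) (ℤ.+ y) (ℤ.+ z) ⟩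
    ℤ.+ N                                       ∎
    where
    open ≡-Reasoning
    +[N+y+z]≡ : ℤ.+ (N + y + z) ≡ ℤ.+ N ℤ.+ ℤ.+ y ℤ.+ ℤ.+ z
    +[N+y+z]≡ = trans (ℤ.pos-+ (N + y) z) (cong (ℤ._+ ℤ.+ z) (ℤ.pos-+ N y))

-- W = (A²m − Y²) + (B²m − Z²t) + 2ABm ≥ 2ABm, and (2ABm)² = 4·A²m·B²m ≥ 4·Y²·Z²t.
SqrtIneq-+ : ∀ {A B m Y Z t} → Y * Y ≤ A * A * m → Z * Z * t ≤ B * B * m →
             SqrtIneq (A + B) m Y Z t
SqrtIneq-+ {A} {B} {m} {Y} {Z} {t} Y²≤A²m Z²t≤B²m
  with a , Y²+a≡A²m ← m≤n⇒∃[o]m+o≡n Y²≤A²m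
     | b , Z²t+b≡B²m ← m≤n⇒∃[o]m+o≡n Z²t≤B²m =
  SqrtIneq-intro {A + B} {m} {Y} {Z} {t} (a + b + 2 * (A * B * m)) expand bound
  where
  expand : (A + B) * (A + B) * m ≡ a + b + 2 * (A * B * m) + Y * Y + Z * Z * t
  expand = begin
    (A + B) * (A + B) * m                          ≡⟨ solve (A ∷ B ∷ m ∷ []) ⟩
    A * A * m + B * B * m + 2 * (A * B * m)        ≡⟨ cong₂ (λ u v → u + v + 2 * (A * B * m)) Y²+a≡A²m Z²t+b≡B²m ⟨
    Y * Y + a + (Z * Z * t + b) + 2 * (A * B * m)  ≡⟨ solve (A ∷ B ∷ m ∷ Y ∷ Z ∷ t ∷ a ∷ b ∷ []) ⟩
    a + b + 2 * (A * B * m) + Y * Y + Z * Z * t    ∎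
    where open ≡-Reasoning
  bound : 4 * (Y * Y) * (Z * Z) * t ≤ (a + b + 2 * (A * B * m)) * (a + b + 2 * (A * B * m))
  bound = begin
    4 * (Y * Y) * (Z * Z) * t                       ≡⟨ solve (Y ∷ Z ∷ t ∷ []) ⟩
    4 * (Y * Y) * (Z * Z * t)                       ≤⟨ *-mono-≤ (*-monoʳ-≤ 4 Y²≤A²m) Z²t≤B²m ⟩
    4 * (A * A * m) * (B * B * m)                   ≡⟨ solve (A ∷ B ∷ m ∷ []) ⟩
    2 * (A * B * m) * (2 * (A * B * m))             ≤⟨ *-mono-≤ (m≤n+m _ (a + b)) (m≤n+m _ (a + b)) ⟩
    (a + b + 2 * (A * B * m)) * (a + b + 2 * (A * B * m)) ∎
    where open ≤-Reasoning

m*n≤[m+n]² : ∀ m n → m * n ≤ (m + n) * (m + n)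
m*n≤[m+n]² m n = *-mono-≤ (m≤m+n m n) (m≤n+m n m)

wedgeBounds⇒SqrtIneq : ∀ m P Δ t K → Δ * Δ ≤ 3 * P → 3 * t ≤ P → P * (3 * m) ≤ K * K →
                       SqrtIneq (4 * K) m (3 * m * Δ) (3 * m) t
wedgeBounds⇒SqrtIneq m P Δ t K Δ²≤3P 3t≤P 3Pm≤K² =
  subst (λ X → SqrtIneq X m (3 * m * Δ) (3 * m) t) (+-comm (3 * K) K)
        (SqrtIneq-+ {3 * K} {K} {m} {3 * m * Δ} {3 * m} {t} Δ-term t-term)
  where
  open ≤-Reasoning
  Δ-term : 3 * m * Δ * (3 * m * Δ) ≤ 3 * K * (3 * K) * m
  Δ-term = begin
    3 * m * Δ * (3 * m * Δ)  ≡⟨ solve (m ∷ Δ ∷ []) ⟩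
    9 * (m * m) * (Δ * Δ)    ≤⟨ *-monoʳ-≤ (9 * (m * m)) Δ²≤3P ⟩
    9 * (m * m) * (3 * P)    ≡⟨ solve (m ∷ P ∷ []) ⟩
    9 * m * (P * (3 * m))    ≤⟨ *-monoʳ-≤ (9 * m) 3Pm≤K² ⟩
    9 * m * (K * K)          ≡⟨ solve (m ∷ K ∷ []) ⟩
    3 * K * (3 * K) * m      ∎
  t-term : 3 * m * (3 * m) * t ≤ K * K * m
  t-term = begin
    3 * m * (3 * m) * t      ≡⟨ solve (m ∷ t ∷ []) ⟩
    3 * (m * m) * (3 * t)    ≤⟨ *-monoʳ-≤ (3 * (m * m)) 3t≤P ⟩
    3 * (m * m) * P          ≡⟨ solve (m ∷ P ∷ []) ⟩
    m * (P * (3 * m))        ≤⟨ *-monoʳ-≤ m 3Pm≤K² ⟩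
    m * (K * K)              ≡⟨ solve (m ∷ K ∷ []) ⟩
    K * K * m                ∎

transitivity-inequality : ∀ {n} (G : SimpleGraph n) →
  SqrtIneq (4 * (wedgeCount G + 3 * edgeCount G)) (edgeCount G)
           (3 * edgeCount G * maxEdgeTriangles G) (3 * edgeCount G) (triangleCount G)
transitivity-inequality G =
  wedgeBounds⇒SqrtIneq m P₂ (maxEdgeTriangles G) (triangleCount G) (P₂ + 3 * m)
    (maxEdgeTriangles²≤3*wedgeCount G) (3*triangleCount≤wedgeCount G) (m*n≤[m+n]² P₂ (3 * m))
  where
  m P₂ : ℕ
  m  = edgeCount G
  P₂ = wedgeCount G

mainTheorem17 : Σ ℕ λ p → Σ ℕ λ q → (1 ≤ p) × (1 ≤ q) ×
    (∀ (n : ℕ) (G : SimpleGraph n) → 1 ≤ triangleCount G →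
      SqrtIneq (q * (wedgeCount G + 3 * edgeCount G)) (edgeCount G)
               (3 * p * edgeCount G * maxEdgeTriangles G) (3 * p * edgeCount G)
               (triangleCount G))
mainTheorem17 = 1 , 4 , ≤-refl , s≤s z≤n , λ _ G _ → transitivity-inequality G
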